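{- Let $d\ge1$ and $q\ge3$ be integers, let $G$ be a connected $K_{1,d}$-free graph without induced cycles of length at least $q$, and let $P$ be an induced path in $G$. Let $H$ be a connected component of $G-N[V(P)]$ and let $v\in N(V(H))\cap N(V(P))$. Then there exists a path $P_H\subseteq P$ on at most $2(d-1)(q-2)+2q$ vertices such that $N(V(H))\subseteq N(V(P_H))$.
   Context: Graphs are finite and simple; $K_{1,d}$-free means no induced star with $d$ leaves. For a vertex set $X$, $N(X)$ is the set of vertices outside $X$ adjacent to some vertex of $X$, and $N[X]=X\cup N(X)$. $P_H\subseteq P$ means $P_H$ is a subpath of $P$. -}

module Defs where

open import Data.Nat using (ℕ; zero; suc; _+_; _*_; _∸_; _≤_; _<_)
open import Data.Fin using (Fin; toℕ)
open import Data.Bool using (Bool; true; false)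
open import Data.Product using (Σ; ∃; _×_; _,_)
open import Data.Sum using (_⊎_)
open import Data.Unit using (⊤)
open import Relation.Nullary using (¬_)
open import Relation.Binary.PropositionalEquality using (_≡_; _≢_)
open import Function.Bundles using (_⇔_)

record Graph (n : ℕ) : Set where
  field
    adj    : Fin n → Fin n → Bool
    sym    : ∀ u v → adj u v ≡ adj v u
    irrefl : ∀ u → adj u u ≡ false
open Graph public

CycSucc : (k : ℕ) → Fin k → Fin k → Set
CycSucc k i j = toℕ j ≡ suc (toℕ i) ⊎ (suc (toℕ i) ≡ k × toℕ j ≡ 0)

module _ {n : ℕ} (G : Graph n) where

  Adj : Fin n → Fin n → Set
  Adj u v = adj G u v ≡ true

  data WalkIn (S : Fin n → Set) : Fin n → Fin n → Set where
    here : ∀ {u} → S u → WalkIn S u u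
    step : ∀ {u x w} → S u → Adj u x → WalkIn S x w → WalkIn S u w

  Connected : Set
  Connected = ∀ u w → WalkIn (λ _ → ⊤) u w

  K1-Free : ℕ → Set
  K1-Free d = ¬ (Σ (Fin n) λ c → Σ (Fin d → Fin n) λ f →
                  (∀ i j → f i ≡ f j → i ≡ j) ×
                  (∀ i → Adj c (f i)) ×
                  (∀ i j → i ≢ j → ¬ Adj (f i) (f j)))

  IsInducedCycle : (k : ℕ) → (Fin k → Fin n) → Set
  IsInducedCycle k c =
    3 ≤ k ×
    (∀ i j → c i ≡ c j → i ≡ j) ×
    (∀ i j → Adj (c i) (c j) ⇔
       (CycSucc k i j ⊎ CycSucc k j i))

  NoLongInducedCycle : ℕ → Set
  NoLongInducedCycle q =
    ∀ k (c : Fin k → Fin n) → q ≤ k → ¬ IsInducedCycle k c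

  IsInducedPath : (m : ℕ) → (Fin m → Fin n) → Set
  IsInducedPath m p =
    (∀ i j → p i ≡ p j → i ≡ j) ×
    (∀ i j → Adj (p i) (p j) ⇔
       (toℕ j ≡ suc (toℕ i) ⊎ toℕ i ≡ suc (toℕ j)))

  N : (Fin n → Set) → Fin n → Set
  N X v = ¬ X v × Σ (Fin n) λ x → X x × Adj x v

  N[_] : (Fin n → Set) → Fin n → Set
  N[ X ] v = X v ⊎ N X v

  IsComponentOfMinus : (Fin n → Set) → (Fin n → Set) → Set
  IsComponentOfMinus Y H =
    (Σ (Fin n) H) ×
    (∀ v → H v → ¬ Y v) ×
    (∀ u w → H u → H w → WalkIn H u w) ×
    (∀ u w → H u → ¬ Y w → Adj u w → H w)

VSet : ∀ {n m} → (Fin m → Fin n) → Fin n → Set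
VSet p v = ∃ λ i → p i ≡ v

SubVSet : ∀ {n m} → (Fin m → Fin n) → ℕ → ℕ → Fin n → Set
SubVSet p a b v = ∃ λ i → a ≤ toℕ i × toℕ i ≤ b × p i ≡ v

module Submission where

-- Let R be the largest index at which some vertex of N(H) has its first
-- neighbour on P, attained by w. Every u ∈ N(H) has a neighbour P_k with
-- R - (q - 3) ≤ k ≤ R: take the largest k ≤ R (u first meets P at or before
-- P_R); if k < R, then w, P_R, …, P_k, u and an induced path from u through H
-- that meets N(w) only at its end form an induced cycle (w has no neighbour
-- below P_R, u none in P_(k+1) … P_R, and H sees no vertex of P) of length at
-- least R - k + 3, so R - k ≤ q - 4. Hence a subpath on q - 2 vertices
-- suffices.

open import Defs
open import Data.Nat using (ℕ; zero; suc; _+_; _*_; _∸_; _≤_; _<_; z≤n; z<s; s≤s; s≤s⁻¹)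
open import Data.Nat.Properties using
  ( suc-injective; ≰⇒>; ≮⇒≥; <-irrefl; n≤1+n; ≤-refl; ≤-trans; <⇒≱; m≤n⇒m<n∨m≡n; m≤n⇒m≤1+n
  ; +-suc; ≤-reflexive; +-identityʳ; _≤?_; <⇒≤; <-trans; n<1+n; m<n⇒m<1+n; +-cancelʳ-≡
  ; +-monoˡ-≤; +-monoʳ-≤; +-monoˡ-<; ≤-<-trans; allUpTo?; m∸n≤m; m≤n+o⇒m∸n≤o; m∸n+n≡m
  ; m+n≤o⇒m≤o∸n; +-comm; m<m+n; m≤n+m∸n; m≤m+n; m≤n+m; module ≤-Reasoning
  )
open import Data.Fin using (Fin; toℕ; fromℕ<) renaming (zero to fzero; suc to fsuc; _<_ to _<ᶠ_)
import Data.Fin.Properties as Fin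
open import Data.Bool using (true; _≟_)
open import Data.Product using (Σ; _×_; _,_; proj₁; proj₂)
open import Data.Sum using (_⊎_; inj₁; inj₂; swap; [_,_]) renaming (map to ⊎-map)
open import Data.Unit using (⊤; tt)
open import Data.Empty using (⊥; ⊥-elim)
open import Data.List using (List; []; _∷_; _++_; length; lookup; applyDownFrom)
open import Data.List.Relation.Unary.All as All using (All; []; _∷_)
open import Data.List.Properties using (length-++; length-applyDownFrom)
open import Data.List.Relation.Unary.All.Properties using (++⁺; ¬Any⇒All¬; anti-mono)
open import Data.List.Relation.Unary.Any as Any using (Any; here; there)
open import Data.List.Relation.Binary.Subset.Propositional using (_⊆_)
open import Data.List.Relation.Binary.Subset.Propositional.Properties using (⊆-trans; xs⊆x∷xs; ∷⁺ʳ)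
open import Data.List.Membership.Propositional.Properties using (∈-lookup)
open import Function using (_∘_; id)
open import Function.Bundles using (_⇔_; mk⇔; Equivalence)
open import Function.Construct.Composition using (_⇔-∘_)
open import Function.Construct.Symmetry using (⇔-sym)
open import Relation.Nullary using (¬_; Dec; yes; no)
open import Relation.Nullary.Decidable using (_⊎-dec_; _×-dec_; ¬?; map′)
open import Relation.Unary using (Decidable)
open import Relation.Binary.PropositionalEquality as ≡ using (_≡_; _≢_; refl; cong; trans)

swap⇔ : ∀ {A B : Set} → (A ⊎ B) ⇔ (B ⊎ A)
swap⇔ = mk⇔ swap swap

least : ∀ {Q : ℕ → Set} → Decidable Q → ∀ {k} → Q k → Σ ℕ λ j → Q j × (∀ {l} → l < j → ¬ Q l)
least Q? {k} qk with Q? 0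
... | yes q0 = 0 , q0 , λ ()
least Q? {zero} qk | no ¬q0 = ⊥-elim (¬q0 qk)
least Q? {suc k} qk | no ¬q0 with least (λ l → Q? (suc l)) qk
... | j , qj , below = suc j , qj , λ { {zero} _ → ¬q0 ; {suc l} l<j → below (s≤s⁻¹ l<j) }

private
  extend-above : ∀ {Q : ℕ → Set} {j b} → ¬ Q (suc b) → (∀ {l} → j < l → l ≤ b → ¬ Q l) →
                 ∀ {l} → j < l → l ≤ suc b → ¬ Q l
  extend-above ¬q above j<l l≤sb with m≤n⇒m<n∨m≡n l≤sb
  ... | inj₁ l<sb = above j<l (s≤s⁻¹ l<sb)
  ... | inj₂ refl = ¬q

greatest≤ : ∀ {Q : ℕ → Set} → Decidable Q → ∀ b {k} → k ≤ b → Q k →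
            Σ ℕ λ j → j ≤ b × Q j × (∀ {l} → j < l → l ≤ b → ¬ Q l)
greatest≤ Q? b k≤b qk with Q? b
... | yes qb = b , ≤-refl , qb , λ b<l l≤b _ → <⇒≱ b<l l≤b
greatest≤ Q? zero z≤n qk | no ¬qb = ⊥-elim (¬qb qk)
greatest≤ Q? (suc b) k≤sb qk | no ¬qb with m≤n⇒m<n∨m≡n k≤sb
... | inj₂ refl = ⊥-elim (¬qb qk)
... | inj₁ k<sb with greatest≤ Q? b (s≤s⁻¹ k<sb) qk
...   | j , j≤b , qj , above = j , m≤n⇒m≤1+n j≤b , qj , extend-above ¬qb above

m∸[m∸n]≤n : ∀ m n → m ∸ (m ∸ n) ≤ n
m∸[m∸n]≤n m n = m≤n+o⇒m∸n≤o m (m ∸ n) (≤-trans (m≤n+m∸n m n) (≤-reflexive (+-comm n (m ∸ n))))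

module InducedPaths {n : ℕ} (G : Graph n) where

  private
    V : Set
    V = Fin n

  Adj-sym : ∀ {u v} → Adj G u v → Adj G v u
  Adj-sym {u} {v} = trans (≡.sym (sym G u v))

  Adj-sym⇔ : ∀ {u v} → Adj G u v ⇔ Adj G v u
  Adj-sym⇔ = mk⇔ Adj-sym Adj-sym

  Adj-irrefl : ∀ u → ¬ Adj G u u
  Adj-irrefl u e with trans (≡.sym (irrefl G u)) e
  ... | ()

  Adj? : ∀ u v → Dec (Adj G u v)
  Adj? u v = adj G u v ≟ true

  OnlyHeadAdj : V → List V → Set
  OnlyHeadAdj x [] = ⊤
  OnlyHeadAdj x (y ∷ ys) = Adj G x y × All (¬_ ∘ Adj G x) ys

  OnlyLastAdj : V → List V → Set
  OnlyLastAdj c [] = ⊥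
  OnlyLastAdj c (z ∷ []) = Adj G c z
  OnlyLastAdj c (z ∷ z′ ∷ zs) = ¬ Adj G c z × OnlyLastAdj c (z′ ∷ zs)

  Induced : List V → Set
  Induced [] = ⊤
  Induced (x ∷ xs) = All (x ≢_) xs × OnlyHeadAdj x xs × Induced xs

  -- The vertices of as and bs are distinct and the only edge between them
  -- joins the last vertex of as to the first of bs.
  Linkable : List V → List V → Set
  Linkable [] bs = ⊤
  Linkable (a ∷ []) bs = All (a ≢_) bs × OnlyHeadAdj a bs
  Linkable (a ∷ a′ ∷ as) bs = All (a ≢_) bs × All (¬_ ∘ Adj G a) bs × Linkable (a′ ∷ as) bs

  ++-induced : ∀ as {bs} → Induced as → Induced bs → Linkable as bs → Induced (as ++ bs)
  ++-induced [] _ ibs _ = ibs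
  ++-induced (a ∷ []) _ ibs (a∉bs , a-bs) = a∉bs , a-bs , ibs
  ++-induced (a ∷ a′ ∷ as) (a∉as , (a-a′ , a≁as) , ias) ibs (a∉bs , a≁bs , link) =
    ++⁺ a∉as a∉bs , (a-a′ , ++⁺ a≁as a≁bs) , ++-induced (a′ ∷ as) ias ibs link

  OnlyLastAdj-∷ : ∀ {c a} zs → ¬ Adj G c a → OnlyLastAdj c zs → OnlyLastAdj c (a ∷ zs)
  OnlyLastAdj-∷ (z ∷ zs) c≁a last = c≁a , last

  OnlyLastAdj-++ : ∀ {c} as {bs} → All (¬_ ∘ Adj G c) as → OnlyLastAdj c bs → OnlyLastAdj c (as ++ bs)
  OnlyLastAdj-++ [] [] last = last
  OnlyLastAdj-++ (a ∷ as) (c≁a ∷ c≁as) last = OnlyLastAdj-∷ (as ++ _) c≁a (OnlyLastAdj-++ as c≁as last)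

  LookupInjective : List V → Set
  LookupInjective xs = ∀ i j → lookup xs i ≡ lookup xs j → i ≡ j

  ∷-lookup-injective : ∀ {x xs} → All (x ≢_) xs → LookupInjective xs → LookupInjective (x ∷ xs)
  ∷-lookup-injective x∉xs inj fzero fzero _ = refl
  ∷-lookup-injective x∉xs inj fzero (fsuc j) e = ⊥-elim (All.lookup x∉xs (∈-lookup j) e)
  ∷-lookup-injective x∉xs inj (fsuc i) fzero e = ⊥-elim (All.lookup x∉xs (∈-lookup i) (≡.sym e))
  ∷-lookup-injective x∉xs inj (fsuc i) (fsuc j) e = cong fsuc (inj i j e)

  OnlyHeadAdj-lookup : ∀ {x} xs → OnlyHeadAdj x xs → ∀ j → Adj G x (lookup xs j) ⇔ (toℕ j ≡ 0)
  OnlyHeadAdj-lookup (y ∷ ys) (x-y , _) fzero = mk⇔ (λ _ → refl) (λ _ → x-y)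
  OnlyHeadAdj-lookup (y ∷ ys) (_ , x≁ys) (fsuc j) =
    mk⇔ (⊥-elim ∘ All.lookup x≁ys (∈-lookup j)) λ ()

  OnlyLastAdj-lookup : ∀ {c} zs → OnlyLastAdj c zs → ∀ j → Adj G c (lookup zs j) ⇔ (suc (toℕ j) ≡ length zs)
  OnlyLastAdj-lookup (z ∷ []) c-z fzero = mk⇔ (λ _ → refl) (λ _ → c-z)
  OnlyLastAdj-lookup (z ∷ z′ ∷ zs) (c≁z , _) fzero = mk⇔ (⊥-elim ∘ c≁z) λ ()
  OnlyLastAdj-lookup (z ∷ z′ ∷ zs) (_ , last) (fsuc j) =
    mk⇔ (cong suc) suc-injective ⇔-∘ OnlyLastAdj-lookup (z′ ∷ zs) last j

  private
    Consecutive : ∀ {k} → Fin k → Fin k → Set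
    Consecutive i j = toℕ j ≡ suc (toℕ i) ⊎ toℕ i ≡ suc (toℕ j)

    consecutive-zero : ∀ {k} (j : Fin k) → Consecutive {suc k} fzero (fsuc j) ⇔ (toℕ j ≡ 0)
    consecutive-zero j = mk⇔ (λ { (inj₁ e) → suc-injective e ; (inj₂ ()) }) (inj₁ ∘ cong suc)

    consecutive-suc : ∀ {k} (i j : Fin k) → Consecutive (fsuc i) (fsuc j) ⇔ Consecutive i j
    consecutive-suc i j = mk⇔ (⊎-map suc-injective suc-injective) (⊎-map (cong suc) (cong suc))

  lookup-induced : ∀ xs → Induced xs → IsInducedPath G (length xs) (lookup xs)
  lookup-induced [] _ = (λ ()) , λ ()
  lookup-induced (x ∷ xs) (x∉xs , x-xs , ixs) =
    ∷-lookup-injective x∉xs (proj₁ (lookup-induced xs ixs)) , adjacency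
    where
      head-adjacency : ∀ j → Adj G x (lookup xs j) ⇔ Consecutive fzero (fsuc j)
      head-adjacency j = ⇔-sym (consecutive-zero j) ⇔-∘ OnlyHeadAdj-lookup xs x-xs j

      adjacency : ∀ i j → Adj G (lookup (x ∷ xs) i) (lookup (x ∷ xs) j) ⇔ Consecutive i j
      adjacency fzero fzero = mk⇔ (⊥-elim ∘ Adj-irrefl x) λ { (inj₁ ()) ; (inj₂ ()) }
      adjacency fzero (fsuc j) = head-adjacency j
      adjacency (fsuc i) fzero = swap⇔ ⇔-∘ (head-adjacency i ⇔-∘ Adj-sym⇔)
      adjacency (fsuc i) (fsuc j) = ⇔-sym (consecutive-suc i j) ⇔-∘ proj₂ (lookup-induced xs ixs) i j

  private
    CyclicallyAdjacent : ∀ k → Fin k → Fin k → Set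
    CyclicallyAdjacent k i j = CycSucc k i j ⊎ CycSucc k j i

    cyclic-zero : ∀ {L} (j : Fin L) →
                  CyclicallyAdjacent (suc L) fzero (fsuc j) ⇔ (toℕ j ≡ 0 ⊎ suc (toℕ j) ≡ L)
    cyclic-zero j = mk⇔
      (λ { (inj₁ (inj₁ e)) → inj₁ (suc-injective e) ; (inj₁ (inj₂ (_ , ())))
         ; (inj₂ (inj₁ ())) ; (inj₂ (inj₂ (e , _))) → inj₂ (suc-injective e) })
      (λ { (inj₁ e) → inj₁ (inj₁ (cong suc e)) ; (inj₂ e) → inj₂ (inj₂ (cong suc e , refl)) })

    cyclic-suc : ∀ {L} (i j : Fin L) → CyclicallyAdjacent (suc L) (fsuc i) (fsuc j) ⇔ Consecutive i j
    cyclic-suc i j = mk⇔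
      (λ { (inj₁ (inj₁ e)) → inj₁ (suc-injective e) ; (inj₁ (inj₂ (_ , ())))
         ; (inj₂ (inj₁ e)) → inj₂ (suc-injective e) ; (inj₂ (inj₂ (_ , ()))) })
      (⊎-map (inj₁ ∘ cong suc) (inj₁ ∘ cong suc))

  apex-cycle : ∀ {c y} ys → Induced (y ∷ ys) → All (c ≢_) (y ∷ ys) → Adj G c y → OnlyLastAdj c ys →
               IsInducedCycle G (suc (suc (length ys))) (lookup (c ∷ y ∷ ys))
  apex-cycle {c} {y} ys@(_ ∷ _) iys c∉ys c-y c-last =
    s≤s (s≤s (s≤s z≤n)) , ∷-lookup-injective c∉ys (proj₁ (lookup-induced (y ∷ ys) iys)) , adjacency
    where
      apex-adjacency : ∀ j → Adj G c (lookup (y ∷ ys) j) ⇔ (toℕ j ≡ 0 ⊎ suc (toℕ j) ≡ length (y ∷ ys))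
      apex-adjacency fzero = mk⇔ (λ _ → inj₁ refl) (λ _ → c-y)
      apex-adjacency (fsuc j) = mk⇔ (inj₂ ∘ cong suc ∘ Equivalence.to last-j)
        λ { (inj₁ ()) ; (inj₂ e) → Equivalence.from last-j (suc-injective e) }
        where
          last-j : Adj G c (lookup ys j) ⇔ (suc (toℕ j) ≡ length ys)
          last-j = OnlyLastAdj-lookup ys c-last j

      adjacency : ∀ i j → Adj G (lookup (c ∷ y ∷ ys) i) (lookup (c ∷ y ∷ ys) j) ⇔ CyclicallyAdjacent _ i j
      adjacency fzero fzero = mk⇔ (⊥-elim ∘ Adj-irrefl c) λ
        { (inj₁ (inj₁ ())) ; (inj₁ (inj₂ (() , _))) ; (inj₂ (inj₁ ())) ; (inj₂ (inj₂ (() , _))) }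
      adjacency fzero (fsuc j) = ⇔-sym (cyclic-zero j) ⇔-∘ apex-adjacency j
      adjacency (fsuc i) fzero = swap⇔ ⇔-∘ (adjacency fzero (fsuc i) ⇔-∘ Adj-sym⇔)
      adjacency (fsuc i) (fsuc j) = ⇔-sym (cyclic-suc i j) ⇔-∘ proj₂ (lookup-induced (y ∷ ys) iys) i j

  apex-path-short : ∀ {q c y} ys → NoLongInducedCycle G q →
                    Induced (y ∷ ys) → All (c ≢_) (y ∷ ys) → Adj G c y → OnlyLastAdj c ys →
                    suc (suc (length ys)) < q
  apex-path-short ys no-long iys c∉ys c-y c-last =
    ≰⇒> λ q≤ → no-long _ _ q≤ (apex-cycle ys iys c∉ys c-y c-last)

  induced-length≤ : ∀ xs → Induced xs → length xs ≤ n
  induced-length≤ xs ixs = ≮⇒≥ λ n<len → repeated (Fin.pigeonhole n<len (lookup xs))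
    where
      repeated : (Σ (Fin (length xs)) λ i → Σ (Fin (length xs)) λ j → i <ᶠ j × lookup xs i ≡ lookup xs j) → ⊥
      repeated (i , j , i<j , e) with proj₁ (lookup-induced xs ixs) i j e
      ... | refl = <-irrefl refl i<j

module Walks {n : ℕ} (G : Graph n) where

  open InducedPaths G

  private
    V : Set
    V = Fin n

  endpoint : V → List V → V
  endpoint y [] = y
  endpoint y (z ∷ zs) = endpoint z zs

  Chain : V → List V → Set
  Chain y [] = ⊤
  Chain y (z ∷ zs) = Adj G y z × Chain z zs

  walk⇒chain : ∀ {S u w} → WalkIn G S u w →
               Σ (List V) λ ys → Chain u ys × All S (u ∷ ys) × endpoint u ys ≡ w
  walk⇒chain (here s) = [] , tt , s ∷ [] , refl
  walk⇒chain (step s u-x walk) with walk⇒chain walk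
  ... | ys , chain , all , end = _ ∷ ys , (u-x , chain) , s ∷ all , end

  endpoint-Any : ∀ {P : V → Set} u ys → P (endpoint u ys) → Any P (u ∷ ys)
  endpoint-Any u [] p = here p
  endpoint-Any u (y ∷ ys) p = there (endpoint-Any y ys p)

  data Suffix : List V → List V → Set where
    done : ∀ {xs} → Suffix xs xs
    skip : ∀ {x xs ys} → Suffix ys xs → Suffix ys (x ∷ xs)

  Suffix⇒⊆ : ∀ {xs ys} → Suffix xs ys → xs ⊆ ys
  Suffix⇒⊆ done = id
  Suffix⇒⊆ (skip s) = there ∘ Suffix⇒⊆ s

  Suffix-induced : ∀ {xs ys} → Suffix xs ys → Induced ys → Induced xs
  Suffix-induced done iys = iys
  Suffix-induced (skip s) (_ , _ , iys) = Suffix-induced s iys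

  Suffix-OnlyLastAdj : ∀ {c z zs ys} → Suffix (z ∷ zs) ys → OnlyLastAdj c ys → OnlyLastAdj c (z ∷ zs)
  Suffix-OnlyLastAdj done c-last = c-last
  Suffix-OnlyLastAdj {ys = _ ∷ []} (skip ()) _
  Suffix-OnlyLastAdj {ys = _ ∷ _ ∷ _} (skip s) (_ , c-last) = Suffix-OnlyLastAdj s c-last

  Suffix-endpoint : ∀ {z zs y ys} → Suffix (z ∷ zs) (y ∷ ys) → endpoint z zs ≡ endpoint y ys
  Suffix-endpoint done = refl
  Suffix-endpoint {ys = []} (skip ())
  Suffix-endpoint {ys = _ ∷ _} (skip s) = Suffix-endpoint s

  Touches : V → V → Set
  Touches y z = y ≡ z ⊎ Adj G y z

  last-touching : ∀ y zs → Any (Touches y) zs →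
    Σ V λ z → Σ (List V) λ S → Suffix (z ∷ S) zs × Touches y z × All (¬_ ∘ Touches y) S
  last-touching y (z ∷ zs) touches with Any.any? (λ z → y Fin.≟ z ⊎-dec Adj? y z) zs
  ... | yes later with last-touching y zs later
  ...   | z′ , S , suffix , t , rest = z′ , S , skip suffix , t , rest
  last-touching y (z ∷ zs) (here t) | no none = z , zs , done , t , ¬Any⇒All¬ zs none
  last-touching y (z ∷ zs) (there t) | no none = ⊥-elim (none t)

  record Shortcut (y : V) (ys : List V) : Set where
    field
      path : List V
      induced : Induced (y ∷ path)
      path⊆ : path ⊆ ys
      keeps-OnlyLastAdj : ∀ {c} → OnlyLastAdj c (y ∷ ys) → OnlyLastAdj c (y ∷ path)
      keeps-endpoint : endpoint y path ≡ endpoint y ys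

  -- Shortcut the rest of the walk first; then y jumps to the last vertex of
  -- that induced path which it equals or is adjacent to.
  shortcut : ∀ y ys → Chain y ys → Shortcut y ys
  shortcut y [] _ = record
    { path = [] ; induced = [] , tt , tt ; path⊆ = id ; keeps-OnlyLastAdj = id ; keeps-endpoint = refl }
  shortcut y (y′ ∷ ys) (y-y′ , chain) with shortcut y′ ys chain
  ... | s with last-touching y (y′ ∷ Shortcut.path s) (here (inj₂ y-y′))
  ... | z , S , suffix , touch , untouched with y Fin.≟ z
  ...   | yes refl = record
    { path = S
    ; induced = Suffix-induced suffix (Shortcut.induced s)
    ; path⊆ = ⊆-trans (xs⊆x∷xs S y) (⊆-trans (Suffix⇒⊆ suffix) (∷⁺ʳ y′ (Shortcut.path⊆ s)))
    ; keeps-OnlyLastAdj = λ { (_ , c-last) → Suffix-OnlyLastAdj suffix (Shortcut.keeps-OnlyLastAdj s c-last) }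
    ; keeps-endpoint = trans (Suffix-endpoint suffix) (Shortcut.keeps-endpoint s)
    }
  ...   | no y≢z = record
    { path = z ∷ S
    ; induced = y≢z ∷ All.map (_∘ inj₁) untouched , (y-z touch , All.map (_∘ inj₂) untouched) ,
                Suffix-induced suffix (Shortcut.induced s)
    ; path⊆ = ⊆-trans (Suffix⇒⊆ suffix) (∷⁺ʳ y′ (Shortcut.path⊆ s))
    ; keeps-OnlyLastAdj = λ { (c≁y , c-last) → c≁y , Suffix-OnlyLastAdj suffix (Shortcut.keeps-OnlyLastAdj s c-last) }
    ; keeps-endpoint = trans (Suffix-endpoint suffix) (Shortcut.keeps-endpoint s)
    }
    where
      y-z : Touches y z → Adj G y z
      y-z (inj₁ y≡z) = ⊥-elim (y≢z y≡z)
      y-z (inj₂ a) = a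

  truncate : ∀ c u ys → Chain u ys → Any (Adj G c) (u ∷ ys) →
             Σ (List V) λ zs → Chain u zs × zs ⊆ ys × OnlyLastAdj c (u ∷ zs)
  truncate c u ys chain c~ with Adj? c u
  ... | yes c-u = [] , tt , (λ ()) , c-u
  truncate c u [] _ (here c-u) | no c≁u = ⊥-elim (c≁u c-u)
  truncate c u (y ∷ ys) _ (here c-u) | no c≁u = ⊥-elim (c≁u c-u)
  truncate c u (y ∷ ys) (u-y , chain) (there c~) | no c≁u with truncate c y ys chain c~
  ... | zs , chain′ , zs⊆ys , c-last = y ∷ zs , (u-y , chain′) , ∷⁺ʳ y zs⊆ys , c≁u , c-last

  induced-path-to-neighbour : ∀ {c u} ys → Chain u ys → Adj G c (endpoint u ys) →
    Σ (List V) λ M → Induced (u ∷ M) × M ⊆ ys × OnlyLastAdj c (u ∷ M)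
  induced-path-to-neighbour {c} {u} ys chain c-end
    with truncate c u ys chain (endpoint-Any u ys c-end)
  ... | zs , chain′ , zs⊆ys , c-last =
    path , induced , ⊆-trans path⊆ zs⊆ys , keeps-OnlyLastAdj c-last
    where open Shortcut (shortcut u zs chain′)

module Component {n : ℕ} (G : Graph n) {Y H : Fin n → Set} (component : IsComponentOfMinus G Y H) where

  h₀ : Fin n
  h₀ = proj₁ (proj₁ component)

  h₀∈H : H h₀
  h₀∈H = proj₂ (proj₁ component)

  H-avoids-Y : ∀ {w} → H w → ¬ Y w
  H-avoids-Y = proj₁ (proj₂ component) _

  H-connected : ∀ {u w} → H u → H w → WalkIn G H u w
  H-connected = proj₁ (proj₂ (proj₂ component)) _ _

  H-closed : ∀ {u w} → H u → ¬ Y w → Adj G u w → H w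
  H-closed = proj₂ (proj₂ (proj₂ component)) _ _

-- The extremal choices in the proof need membership in H to be decidable.
module ComponentDecidable {n : ℕ} (G : Graph n) {Y H : Fin n → Set} (Y? : Decidable Y)
                          (component : IsComponentOfMinus G Y H) where

  open InducedPaths G
  open Walks G

  open Component G component

  Reach : ℕ → Fin n → Set
  Reach zero w = w ≡ h₀
  Reach (suc k) w = Reach k w ⊎ (¬ Y w × Σ (Fin n) λ u → Reach k u × Adj G u w)

  Reach? : ∀ k → Decidable (Reach k)
  Reach? zero w = w Fin.≟ h₀
  Reach? (suc k) w = Reach? k w ⊎-dec (¬? (Y? w) ×-dec Fin.any? (λ u → Reach? k u ×-dec Adj? u w))

  Reach⇒H : ∀ k {w} → Reach k w → H w
  Reach⇒H zero refl = h₀∈H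
  Reach⇒H (suc k) (inj₁ r) = Reach⇒H k r
  Reach⇒H (suc k) (inj₂ (w∉Y , u , r , u-w)) = H-closed (Reach⇒H k r) w∉Y u-w

  Reach-mono : ∀ {k j w} → k ≤ j → Reach k w → Reach j w
  Reach-mono {zero} {zero} _ r = r
  Reach-mono {zero} {suc j} _ r = inj₁ (Reach-mono {zero} z≤n r)
  Reach-mono {suc k} {suc j} k≤j (inj₁ r) = Reach-mono (m≤n⇒m≤1+n (s≤s⁻¹ k≤j)) r
  Reach-mono {suc k} {suc j} k≤j (inj₂ (w∉Y , u , r , u-w)) = inj₂ (w∉Y , u , Reach-mono (s≤s⁻¹ k≤j) r , u-w)

  induced-Reach : ∀ {y k} Z → Induced (y ∷ Z) → All H Z → Reach k y → Reach (k + length Z) (endpoint y Z)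
  induced-Reach {k = k} [] _ _ r = ≡.subst (λ j → Reach j _) (≡.sym (+-identityʳ k)) r
  induced-Reach {y} {k} (z ∷ Z) (_ , (y-z , _) , iZ) (z∈H ∷ Z⊆H) r =
    ≡.subst (λ j → Reach j (endpoint z Z)) (≡.sym (+-suc k (length Z)))
      (induced-Reach Z iZ Z⊆H (inj₂ (H-avoids-Y z∈H , y , r , y-z)))

  H⇒Reach : ∀ {w} → H w → Reach n w
  H⇒Reach w∈H with walk⇒chain (H-connected h₀∈H w∈H)
  ... | ys , chain , _ ∷ ys⊆H , end = Reach-mono length≤n
        (≡.subst (Reach _) (trans (Shortcut.keeps-endpoint s) end)
          (induced-Reach (Shortcut.path s) (Shortcut.induced s) (anti-mono (Shortcut.path⊆ s) ys⊆H) refl))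
    where
      s : Shortcut h₀ ys
      s = shortcut h₀ ys chain
      length≤n : length (Shortcut.path s) ≤ n
      length≤n = ≤-trans (n≤1+n _) (induced-length≤ (h₀ ∷ Shortcut.path s) (Shortcut.induced s))

  component? : Decidable H
  component? w = map′ (Reach⇒H n) H⇒Reach (Reach? n w)

module PathIndexing {n m : ℕ} (G : Graph n) (P : Fin (suc m) → Fin n)
                    (P-induced : IsInducedPath G (suc m) P) where

  open InducedPaths G

  -- Indices beyond the end of the path are sent to its first vertex.
  index : ℕ → Fin (suc m)
  index k with k ≤? m
  ... | yes k≤m = fromℕ< (s≤s k≤m)
  ... | no _ = fzero

  toℕ-index : ∀ {k} → k ≤ m → toℕ (index k) ≡ k
  toℕ-index {k} k≤m with k ≤? m
  ... | yes _ = Fin.toℕ-fromℕ< _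
  ... | no k≰m = ⊥-elim (k≰m k≤m)

  at : ℕ → Fin n
  at = P ∘ index

  at-toℕ : ∀ i → at (toℕ i) ≡ P i
  at-toℕ i = cong P (Fin.toℕ-injective (toℕ-index (Fin.toℕ≤pred[n] i)))

  at∈P : ∀ k → VSet P (at k)
  at∈P k = index k , refl

  at-injective : ∀ {k l} → k ≤ m → l ≤ m → at k ≡ at l → k ≡ l
  at-injective k≤m l≤m e =
    trans (≡.sym (toℕ-index k≤m)) (trans (cong toℕ (proj₁ P-induced _ _ e)) (toℕ-index l≤m))

  at-adjacent : ∀ {k} → suc k ≤ m → Adj G (at k) (at (suc k))
  at-adjacent {k} sk≤m = Equivalence.from (proj₂ P-induced (index k) (index (suc k)))
    (inj₁ (trans (toℕ-index sk≤m) (cong suc (≡.sym (toℕ-index (≤-trans (n≤1+n k) sk≤m))))))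

  at-consecutive : ∀ {k l} → k ≤ m → l ≤ m → Adj G (at k) (at l) → l ≡ suc k ⊎ k ≡ suc l
  at-consecutive k≤m l≤m a = ⊎-map
    (λ e → trans (≡.sym (toℕ-index l≤m)) (trans e (cong suc (toℕ-index k≤m))))
    (λ e → trans (≡.sym (toℕ-index k≤m)) (trans e (cong suc (toℕ-index l≤m))))
    (Equivalence.to (proj₂ P-induced _ _) a)

  at-far : ∀ {k l} → l ≤ m → suc k < l → ¬ Adj G (at k) (at l)
  at-far {k} l≤m sk<l a with at-consecutive (≤-trans (≤-trans (n≤1+n k) (<⇒≤ sk<l)) l≤m) l≤m a
  ... | inj₁ refl = <-irrefl refl sk<l
  ... | inj₂ refl = <-irrefl refl (<-trans (n<1+n _) (<-trans (n<1+n _) sk<l))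

  at∈SubVSet : ∀ {a b k} → b ≤ m → a ≤ k → k ≤ b → SubVSet P a b (at k)
  at∈SubVSet {k = k} b≤m a≤k k≤b = index k , ≡.subst (_ ≤_) e a≤k , ≡.subst (_≤ _) e k≤b , refl
    where
      e : k ≡ toℕ (index k)
      e = ≡.sym (toℕ-index (≤-trans k≤b b≤m))

  stretch : ℕ → ℕ → List (Fin n)
  stretch i = applyDownFrom (λ s → at (s + i))

  length-stretch : ∀ i l → length (stretch i l) ≡ l
  length-stretch i = length-applyDownFrom (λ s → at (s + i))

  All-stretch : ∀ {Q : Fin n → Set} i l → (∀ {s} → s < l → Q (at (s + i))) → All Q (stretch i l)
  All-stretch i zero _ = []
  All-stretch i (suc l) q = q ≤-refl ∷ All-stretch i l (q ∘ m<n⇒m<1+n)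

  stretch-induced : ∀ i l → l + i ≤ suc m → Induced (stretch i l)
  stretch-induced i zero _ = tt
  stretch-induced i (suc l) bound = distinct , head-adjacent l top≤m , stretch-induced i l (m≤n⇒m≤1+n top≤m)
    where
      top≤m : l + i ≤ m
      top≤m = s≤s⁻¹ bound

      distinct : All (at (l + i) ≢_) (stretch i l)
      distinct = All-stretch i l λ s<l e →
        <-irrefl (≡.sym (+-cancelʳ-≡ i l _ (at-injective top≤m (≤-trans (+-monoˡ-≤ i (<⇒≤ s<l)) top≤m) e))) s<l

      head-adjacent : ∀ l → l + i ≤ m → OnlyHeadAdj (at (l + i)) (stretch i l)
      head-adjacent zero _ = tt
      head-adjacent (suc l) top≤m = Adj-sym (at-adjacent top≤m) ,
        All-stretch i l λ s<l → at-far top≤m (s≤s (+-monoˡ-≤ i s<l)) ∘ Adj-sym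

  stretch-linkable : ∀ i l X →
    (∀ {s} → s ≤ l → All (at (s + i) ≢_) X) →
    (∀ {s} → 0 < s → s ≤ l → All (¬_ ∘ Adj G (at (s + i))) X) →
    OnlyHeadAdj (at i) X → Linkable (stretch i (suc l)) X
  stretch-linkable i zero X distinct far head = distinct z≤n , head
  stretch-linkable i (suc l) X distinct far head = distinct ≤-refl , far z<s ≤-refl ,
    stretch-linkable i l X (distinct ∘ m≤n⇒m≤1+n) (λ 0<s → far 0<s ∘ m≤n⇒m≤1+n) head

module Attachment {n : ℕ} (G : Graph n) (q : ℕ) (no-long : NoLongInducedCycle G q)
                  {m : ℕ} (P : Fin (suc m) → Fin n) (P-induced : IsInducedPath G (suc m) P)
                  (H : Fin n → Set) (component : IsComponentOfMinus G (N[_] G (VSet P)) H) where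

  open InducedPaths G
  open Walks G
  open PathIndexing G P P-induced

  open Component G component

  VSet? : Decidable (VSet P)
  VSet? x = Fin.any? λ i → P i Fin.≟ x

  N-VSet? : Decidable (N G (VSet P))
  N-VSet? x = ¬? (VSet? x) ×-dec Fin.any? (λ y → VSet? y ×-dec Adj? y x)

  H? : Decidable H
  H? = ComponentDecidable.component? G (λ x → VSet? x ⊎-dec N-VSet? x) component

  N-H? : Decidable (N G H)
  N-H? x = ¬? (H? x) ×-dec Fin.any? (λ y → H? y ×-dec Adj? y x)

  H-off-P : ∀ {z} → H z → ¬ VSet P z
  H-off-P z∈H = H-avoids-Y z∈H ∘ inj₁

  H-off-at : ∀ {z} k → H z → at k ≢ z
  H-off-at k z∈H refl = H-off-P z∈H (at∈P k)

  H-not-adjacent-at : ∀ {z} k → H z → ¬ Adj G (at k) z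
  H-not-adjacent-at k z∈H a = H-avoids-Y z∈H (inj₂ (H-off-P z∈H , at k , at∈P k , a))

  N-H⊆N-P : ∀ {u} → N G H u → N G (VSet P) u
  N-H⊆N-P {u} (u∉H , h , h∈H , h-u) with VSet? u | N-VSet? u
  ... | yes u∈P | _ = ⊥-elim (H-avoids-Y h∈H (inj₂ (H-off-P h∈H , u , u∈P , Adj-sym h-u)))
  ... | no _ | yes u∈N = u∈N
  ... | no u∉P | no u∉N = ⊥-elim (u∉H (H-closed h∈H [ u∉P , u∉N ] h-u))

  N-P-off-at : ∀ {u} k → N G (VSet P) u → at k ≢ u
  N-P-off-at k (u∉P , _) refl = u∉P (at∈P k)

  Adj-at? : ∀ x → Decidable (λ l → Adj G x (at l))
  Adj-at? x l = Adj? x (at l)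

  FirstAttachment : Fin n → ℕ → Set
  FirstAttachment x r = r ≤ m × Adj G x (at r) × (∀ {l} → l < r → ¬ Adj G x (at l))

  FirstAttachment? : ∀ x r → Dec (FirstAttachment x r)
  FirstAttachment? x r = r ≤? m ×-dec Adj? x (at r) ×-dec allUpTo? (¬? ∘ Adj-at? x) r

  first-attachment : ∀ {x} → N G (VSet P) x → Σ ℕ λ r → FirstAttachment x r
  first-attachment {x} (_ , _ , (i , refl) , i-x) = bound-by-i (least (Adj-at? x) {toℕ i} x-i)
    where
      x-i : Adj G x (at (toℕ i))
      x-i = ≡.subst (Adj G x) (≡.sym (at-toℕ i)) (Adj-sym i-x)

      bound-by-i : (Σ ℕ λ r → Adj G x (at r) × (∀ {l} → l < r → ¬ Adj G x (at l))) → Σ ℕ (FirstAttachment x)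
      bound-by-i (r , x-r , below) = r , ≤-trans (≮⇒≥ λ i<r → below i<r x-i) (Fin.toℕ≤pred[n] i) , x-r , below

  detour-through-H : ∀ {u w} → N G H u → N G H w →
    Σ (List (Fin n)) λ M → All H M × Induced (u ∷ M) × OnlyLastAdj w (u ∷ M)
  detour-through-H (_ , h₁ , h₁∈H , h₁-u) (_ , h₂ , h₂∈H , h₂-w)
    with walk⇒chain (H-connected h₁∈H h₂∈H)
  ... | ys , chain , walk⊆H , refl
    with induced-path-to-neighbour (h₁ ∷ ys) (Adj-sym h₁-u , chain) (Adj-sym h₂-w)
  ... | M , induced , M⊆ , w-last = M , anti-mono M⊆ walk⊆H , induced , w-last

  attachment-gap : ∀ {u w k R} t → suc t + k ≡ R → N G H u → N G H w → FirstAttachment w R →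
    Adj G u (at k) → (∀ {l} → k < l → l ≤ R → ¬ Adj G u (at l)) → suc t + 3 < q
  attachment-gap {u} {w} {k} t refl u∈N-H w∈N-H (R≤m , w-R , w-below) u-k u-gap
    with detour-through-H u∈N-H w∈N-H
  ... | M , M⊆H , induced-uM , w-last =
    ≤-<-trans length-bound (apex-path-short ys no-long induced-ys w∉ys w-R w-last-ys)
    where
      ys : List (Fin n)
      ys = stretch k (suc t) ++ u ∷ M

      linkable : Linkable (stretch k (suc (suc t))) (u ∷ M)
      linkable = stretch-linkable k (suc t) (u ∷ M)
        (λ {s} _ → N-P-off-at (s + k) (N-H⊆N-P u∈N-H) ∷ All.map (H-off-at (s + k)) M⊆H)
        (λ {s} 0<s s≤ → (u-gap (+-monoˡ-< k 0<s) (+-monoˡ-≤ k s≤) ∘ Adj-sym) ∷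
                        All.map (H-not-adjacent-at (s + k)) M⊆H)
        (Adj-sym u-k , All.map (H-not-adjacent-at k) M⊆H)

      induced-ys : Induced (at (suc t + k) ∷ ys)
      induced-ys = ++-induced (stretch k (suc (suc t))) (stretch-induced k (suc (suc t)) (s≤s R≤m))
                              induced-uM linkable

      w∉ys : All (w ≢_) (at (suc t + k) ∷ ys)
      w∉ys = ++⁺ (All-stretch k (suc (suc t)) λ {s} _ → N-P-off-at (s + k) (N-H⊆N-P w∈N-H) ∘ ≡.sym)
                 ((λ { refl → u-gap (+-monoˡ-< k z<s) ≤-refl w-R }) ∷
                  All.map (λ { z∈H refl → proj₁ w∈N-H z∈H }) M⊆H)

      w-last-ys : OnlyLastAdj w ys
      w-last-ys = OnlyLastAdj-++ (stretch k (suc t)) (All-stretch k (suc t) (w-below ∘ +-monoˡ-< k)) w-last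

      length-bound : suc t + 3 ≤ suc (suc (length ys))
      length-bound = begin
        suc t + 3                           ≡⟨ +-comm (suc t) 3 ⟩
        3 + suc t                           ≤⟨ s≤s (s≤s (m<m+n (suc t) z<s)) ⟩
        suc (suc (suc t + suc (length M)))  ≡⟨ cong (suc ∘ suc) (≡.sym length-ys) ⟩
        suc (suc (length ys))               ∎
        where
          open ≤-Reasoning
          length-ys : length ys ≡ suc t + suc (length M)
          length-ys = trans (length-++ (stretch k (suc t)))
                            (cong (_+ suc (length M)) (length-stretch k (suc t)))

  record LatestFirstAttachment : Set where
    field
      R : ℕ
      w : Fin n
      w∈N-H : N G H w
      w-first : FirstAttachment w R
      latest : ∀ {u r} → N G H u → FirstAttachment u r → r ≤ R

  AttainedAt : ℕ → Set
  AttainedAt r = Σ (Fin n) λ u → N G H u × FirstAttachment u r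

  AttainedAt? : Decidable AttainedAt
  AttainedAt? r = Fin.any? λ u → N-H? u ×-dec FirstAttachment? u r

  latest-first-attachment : ∀ {v} → N G H v → LatestFirstAttachment
  latest-first-attachment v∈N-H with first-attachment (N-H⊆N-P v∈N-H)
  ... | r , v-first@(r≤m , _) with greatest≤ AttainedAt? m r≤m (_ , v∈N-H , v-first)
  ... | R , _ , (w , w∈N-H , w-first) , above = record
    { R = R ; w = w ; w∈N-H = w∈N-H ; w-first = w-first
    ; latest = λ u∈N-H u-first@(r≤m , _) → ≮⇒≥ λ R<r → above R<r r≤m (_ , u∈N-H , u-first) }

  module Window (L : LatestFirstAttachment) where
    open LatestFirstAttachment L

    R≤m : R ≤ m
    R≤m = proj₁ w-first

    last-attachment-up-to-R : ∀ {u} → N G H u →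
      Σ ℕ λ k → k ≤ R × Adj G u (at k) × (∀ {l} → k < l → l ≤ R → ¬ Adj G u (at l))
    last-attachment-up-to-R {u} u∈N-H with first-attachment (N-H⊆N-P u∈N-H)
    ... | r , u-first@(_ , u-r , _) = greatest≤ (Adj-at? u) R (latest u∈N-H u-first) u-r

    attachment-window : ∀ {u} → N G H u → Σ ℕ λ k → R ∸ (q ∸ 3) ≤ k × k ≤ R × Adj G u (at k)
    attachment-window u∈N-H with last-attachment-up-to-R u∈N-H
    ... | k , k≤R , u-k , u-gap with m≤n⇒m<n∨m≡n k≤R
    ...   | inj₂ refl = k , m∸n≤m k (q ∸ 3) , k≤R , u-k
    ...   | inj₁ k<R = k , m≤n+o⇒m∸n≤o R (q ∸ 3) R≤ , k≤R , u-k
      where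
        t : ℕ
        t = R ∸ suc k

        R≡ : suc t + k ≡ R
        R≡ = trans (≡.sym (+-suc t k)) (m∸n+n≡m k<R)

        R≤ : R ≤ q ∸ 3 + k
        R≤ = ≡.subst (_≤ q ∸ 3 + k) R≡ (+-monoˡ-≤ k (m+n≤o⇒m≤o∸n (suc t)
               (<⇒≤ (attachment-gap t R≡ u∈N-H w∈N-H w-first u-k u-gap))))

lemma4p6 : (d q : ℕ) → 1 ≤ d → 3 ≤ q →
    (n : ℕ) (G : Graph n) → Connected G → K1-Free G d → NoLongInducedCycle G q →
    (m : ℕ) (P : Fin m → Fin n) → IsInducedPath G m P →
    (H : Fin n → Set) → IsComponentOfMinus G (N[_] G (VSet P)) H →
    (v : Fin n) → N G H v → N G (VSet P) v →
    Σ ℕ λ a → Σ ℕ λ b → a ≤ b × b < m ×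
      suc (b ∸ a) ≤ 2 * (d ∸ 1) * (q ∸ 2) + 2 * q ×
      (∀ u → N G H u → N G (SubVSet P a b) u)
lemma4p6 _ _ _ _ _ _ _ _ _ zero _ _ _ _ _ _ (_ , _ , (() , _) , _)
lemma4p6 d q _ q≥3 n G _ _ no-long (suc m) P P-induced H component v v∈N-H _ =
  R ∸ (q ∸ 3) , R , m∸n≤m R (q ∸ 3) , s≤s R≤m , size , covered
  where
    open InducedPaths G
    open PathIndexing G P P-induced
    open Attachment G q no-long P P-induced H component
    L : LatestFirstAttachment
    L = latest-first-attachment v∈N-H
    open LatestFirstAttachment L
    open Window L

    size : suc (R ∸ (R ∸ (q ∸ 3))) ≤ 2 * (d ∸ 1) * (q ∸ 2) + 2 * q
    size = begin
      suc (R ∸ (R ∸ (q ∸ 3))) ≤⟨ s≤s (m∸[m∸n]≤n R (q ∸ 3)) ⟩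
      suc (q ∸ 3)             ≤⟨ ≤-trans (≤-reflexive (+-comm 1 (q ∸ 3))) (+-monoʳ-≤ (q ∸ 3) (s≤s z≤n)) ⟩
      q ∸ 3 + 3               ≡⟨ m∸n+n≡m q≥3 ⟩
      q                       ≤⟨ m≤m+n q (q + 0) ⟩
      2 * q                   ≤⟨ m≤n+m (2 * q) (2 * (d ∸ 1) * (q ∸ 2)) ⟩
      2 * (d ∸ 1) * (q ∸ 2) + 2 * q ∎
      where open ≤-Reasoning

    covered : ∀ u → N G H u → N G (SubVSet P (R ∸ (q ∸ 3)) R) u
    covered u u∈N-H with attachment-window u∈N-H
    ... | k , a≤k , k≤R , u-k =
      (λ { (i , _ , _ , refl) → proj₁ (N-H⊆N-P u∈N-H) (i , refl) }) ,
      at k , at∈SubVSet R≤m a≤k k≤R , Adj-sym u-k
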